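{- Let $v,k,t$ be integers with $v>k>t\ge 2$. Let $X$ be a $v$-set and let $X=X_1\cup X_2$ be a partition of $X$ (so $X_1\cap X_2=\emptyset$) with $|X_1|=v_1$ and $|X_2|=v_2$. For $i=0,\dots,t$ let $D_i=(X_1,\mathcal{B}^{(i)})$ be the complete $i$-$(v_1,i,1)$ design, i.e. $\mathcal{B}^{(i)}$ is the set of all $i$-subsets of $X_1$; and for $i=t+1,\dots,k$ let $D_i=(X_1,\mathcal{B}^{(i)})$ be a simple $t$-$(v_1,i,\lambda^{(i)}_t)$ design. Similarly, for $i=0,\dots,t$ let $\bar D_i=(X_2,\bar{\mathcal{B}}^{(i)})$ be the complete $i$-$(v_2,i,1)$ design, and for $i=t+1,\dots,k$ let $\bar D_i=(X_2,\bar{\mathcal{B}}^{(i)})$ be a simple $t$-$(v_2,i,\bar\lambda^{(i)}_t)$ design. For $0\le s\le t$ and $0\le i\le k$, let $\lambda^{(i)}_s$ denote the number of blocks of $D_i$ containing a given $s$-subset of $X_1$, and $\bar\lambda^{(i)}_s$ the number of blocks of $\bar D_i$ containing a given $s$-subset of $X_2$ (these numbers do not depend on the chosen subset; they equal $0$ when $s>i$). For $i=0,\dots,k$ put $$\mathcal{B}_{(i,k-i)}=\{B_i\cup \bar B_{k-i}\;:\;B_i\in\mathcal{B}^{(i)},\ \bar B_{k-i}\in\bar{\mathcal{B}}^{(k-i)}\},$$ let $u_0,\dots,u_k\in\{0,1\}$, and define $$\mathcal{B}=\bigcup_{i\,:\,u_i=1}\mathcal{B}_{(i,k-i)}.$$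 For $s=0,\dots,t$ let $$L_{s,t-s}=\sum_{i=0}^k u_i\,\lambda^{(i)}_s\,\bar\lambda^{(k-i)}_{t-s}.$$ Assume that $$L_{0,t}=L_{1,t-1}=L_{2,t-2}=\cdots=L_{t,0}=\Lambda$$ for some positive integer $\Lambda$. Then $(X,\mathcal{B})$ is a simple $t$-$(v,k,\Lambda)$ design.
   Context: A $t$-$(v,k,\lambda)$ design is a pair $(X,\mathcal{B})$ where $X$ is a $v$-set of points and $\mathcal{B}$ is a collection (possibly a multiset) of $k$-subsets of $X$ (blocks) such that every $t$-subset of $X$ is contained in exactly $\lambda$ blocks. It is simple if no block is repeated. The complete $i$-$(w,i,1)$ design on a $w$-set consists of all $i$-subsets; by convention, for $i=0$ it has exactly one block, the empty set, and when $w=i$ it has exactly one block consisting of all $w$ points. -}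

module Defs where

open import Data.Nat using (ℕ; suc; _*_; _∸_)
open import Data.Bool using (Bool; if_then_else_)
open import Data.List using (List; []; length; filter; map; concatMap; upTo)
open import Data.Nat.ListAction using (sum)
open import Data.List.Relation.Unary.All using (All)
open import Data.List.Relation.Unary.Unique.Propositional using (Unique)
open import Data.List.Membership.Propositional using (_∈_)
open import Data.Fin.Subset using (Subset; _⊆_; ∣_∣; _∪_)
open import Data.Fin.Subset.Properties using (_⊆?_)
open import Data.Product using (_×_)
open import Function.Bundles using (_⇔_)
open import Relation.Binary.PropositionalEquality using (_≡_)

-- Points are Fin v; a block / point set is a Subset v.
-- A collection of blocks is a list (a multiset); "simple" = no repetitions.

count : {v : ℕ} → Subset v → List (Subset v) → ℕ
count S Bs = length (filter (λ B → S ⊆? B) Bs)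

IsDesign : {v : ℕ} → Subset v → ℕ → ℕ → ℕ → List (Subset v) → Set
IsDesign P t k lm Bs =
  All (λ B → (B ⊆ P) × (∣ B ∣ ≡ k)) Bs ×
  (∀ T → T ⊆ P → ∣ T ∣ ≡ t → count T Bs ≡ lm)

IsSimpleDesign : {v : ℕ} → Subset v → ℕ → ℕ → ℕ → List (Subset v) → Set
IsSimpleDesign P t k lm Bs = Unique Bs × IsDesign P t k lm Bs

IsComplete : {v : ℕ} → Subset v → ℕ → List (Subset v) → Set
IsComplete P i Bs = Unique Bs × (∀ B → (B ∈ Bs) ⇔ ((B ⊆ P) × (∣ B ∣ ≡ i)))

combine : {v : ℕ} → List (Subset v) → List (Subset v) → List (Subset v)
combine As Bs = concatMap (λ A → map (λ B → A ∪ B) Bs) As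

unionBlocks : {v : ℕ} → ℕ → (ℕ → Bool) → (ℕ → List (Subset v)) → (ℕ → List (Subset v)) → List (Subset v)
unionBlocks k u D D̄ = concatMap (λ i → if u i then combine (D i) (D̄ (k ∸ i)) else []) (upTo (suc k))

bit : Bool → ℕ
bit b = if b then 1 else 0

L : ℕ → ℕ → (ℕ → Bool) → (ℕ → ℕ → ℕ) → (ℕ → ℕ → ℕ) → ℕ → ℕ
L k t u lam lam̄ s = sum (map (λ i → bit (u i) * lam i s * lam̄ (k ∸ i) (t ∸ s)) (upTo (suc k)))

module Submission where

-- Write X₂ = ∁ X₁.  Every block of the mixed design has the form
-- A ∪ B with A an i-subset of X₁ taken from D i and B a (k-i)-subset of X₂ taken
-- from D̄ (k-i).  Since X₁ and X₂ are complementary, A and B are recovered from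
-- A ∪ B as its traces (A ∪ B) ∩ X₁ and (A ∪ B) ∩ X₂; hence
--   * |A ∪ B| = i + (k - i) = k,
--   * distinct pairs give distinct blocks and different layers i are disjoint
--     (the layer is read off as |C ∩ X₁|), so the design is simple,
--   * a t-set T lies in A ∪ B iff T ∩ X₁ ⊆ A and T ∩ X₂ ⊆ B, so T lies in
--     u_i · λ^(i)_s · λ̄^(k-i)_(t-s) blocks of layer i, where s = |T ∩ X₁|;
--     summing over i gives L_{s,t-s} = Λ.

open import Defs
open import Data.Nat using (ℕ; _≤_; _<_; suc; _+_; _*_; _∸_; s≤s; _≤?_)
open import Data.Nat.Properties using (+-suc; *-identityˡ; *-assoc; m≤m+n; m∸n≤m; m+n∸m≡n; m+[n∸m]≡n; ≰⇒>)
open import Data.Bool using (Bool; true; false; if_then_else_)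
open import Data.Vec using ([]; _∷_; here)
open import Data.List using (List; []; _∷_; _++_; map; concatMap; upTo; length; filter)
open import Data.List.Properties using (length-++; filter-++; map-cong-local)
open import Data.Nat.ListAction using (sum)
open import Data.List.Relation.Unary.All as All using (All; []; _∷_)
open import Data.List.Relation.Unary.All.Properties using (map⁺)
open import Data.List.Relation.Unary.Any using (here; there)
open import Data.List.Relation.Unary.Unique.Propositional using (Unique)
open import Data.List.Relation.Unary.AllPairs using ([]; _∷_)
open import Data.List.Relation.Unary.Unique.Propositional.Properties using (++⁺; upTo⁺)
open import Data.List.Membership.Propositional using (_∈_; find)
open import Data.List.Membership.Propositional.Properties using (∈-concatMap⁻; ∈-map⁻; ∈-upTo⁻)
open import Data.Fin.Subset using (Subset; _⊆_; ∣_∣; ∁; ⊤; _∪_; _∩_)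
open import Data.Fin.Subset.Properties
  using (_⊆?_; _∈?_; ⊆⊤; ⊆-antisym; p∩q⊆q; drop-∷-⊆; x∈p∩q⁺; x∈p∩q⁻; x∈p∪q⁺; x∈p∪q⁻; x∈∁p⇒x∉p; x∉p⇒x∈∁p)
open import Data.Product using (_×_; _,_; proj₁; proj₂; ∃₂)
open import Data.Sum using (inj₁; inj₂)
open import Data.Empty using (⊥-elim)
open import Function using (_∘_)
open import Function.Bundles using (_⇔_; mk⇔; Equivalence)
open import Relation.Nullary using (¬_; yes; no)
open import Relation.Binary.PropositionalEquality using (_≡_; refl; sym; trans; cong; cong₂; subst; module ≡-Reasoning)

-- For A ⊆ X and B ⊆ ∁ X, the set A ∪ B is determined by, and determines,
-- its two traces; this is what makes the product construction faithful.
module Split {n : ℕ} (X : Subset n) {A B : Subset n} (A⊆X : A ⊆ X) (B⊆∁X : B ⊆ ∁ X) where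

  ⊆-∪⁻ˡ : ∀ {T} → T ⊆ A ∪ B → T ∩ X ⊆ A
  ⊆-∪⁻ˡ {T} T⊆A∪B x∈T∩X with x∈p∩q⁻ T X x∈T∩X
  ... | x∈T , x∈X with x∈p∪q⁻ A B (T⊆A∪B x∈T)
  ... | inj₁ x∈A = x∈A
  ... | inj₂ x∈B = ⊥-elim (x∈∁p⇒x∉p (B⊆∁X x∈B) x∈X)

  ⊆-∪⁻ʳ : ∀ {T} → T ⊆ A ∪ B → T ∩ ∁ X ⊆ B
  ⊆-∪⁻ʳ {T} T⊆A∪B x∈T∩∁X with x∈p∩q⁻ T (∁ X) x∈T∩∁X
  ... | x∈T , x∈∁X with x∈p∪q⁻ A B (T⊆A∪B x∈T)
  ... | inj₁ x∈A = ⊥-elim (x∈∁p⇒x∉p x∈∁X (A⊆X x∈A))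
  ... | inj₂ x∈B = x∈B

  ⊆-∪⁺ : ∀ {T} → T ∩ X ⊆ A → T ∩ ∁ X ⊆ B → T ⊆ A ∪ B
  ⊆-∪⁺ T∩X⊆A T∩∁X⊆B {x} x∈T with x ∈? X
  ... | yes x∈X = x∈p∪q⁺ (inj₁ (T∩X⊆A (x∈p∩q⁺ (x∈T , x∈X))))
  ... | no  x∉X = x∈p∪q⁺ (inj₂ (T∩∁X⊆B (x∈p∩q⁺ (x∈T , x∉p⇒x∈∁p x∉X))))

  ∪-trace : (A ∪ B) ∩ X ≡ A
  ∪-trace = ⊆-antisym (⊆-∪⁻ˡ (λ x∈ → x∈)) (λ x∈A → x∈p∩q⁺ (x∈p∪q⁺ (inj₁ x∈A) , A⊆X x∈A))

  ∪-traceᶜ : (A ∪ B) ∩ ∁ X ≡ B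
  ∪-traceᶜ = ⊆-antisym (⊆-∪⁻ʳ (λ x∈ → x∈)) (λ x∈B → x∈p∩q⁺ (x∈p∪q⁺ (inj₂ x∈B) , B⊆∁X x∈B))

∣∪∣-split : ∀ {n} (X A B : Subset n) → A ⊆ X → B ⊆ ∁ X → ∣ A ∪ B ∣ ≡ ∣ A ∣ + ∣ B ∣
∣∪∣-split []      []          []          _   _   = refl
∣∪∣-split (_ ∷ X) (true  ∷ A) (true  ∷ B) A⊆X B⊆∁X = ⊥-elim (x∈∁p⇒x∉p (B⊆∁X here) (A⊆X here))
∣∪∣-split (_ ∷ X) (true  ∷ A) (false ∷ B) A⊆X B⊆∁X =
  cong suc (∣∪∣-split X A B (drop-∷-⊆ A⊆X) (drop-∷-⊆ B⊆∁X))
∣∪∣-split (_ ∷ X) (false ∷ A) (true  ∷ B) A⊆X B⊆∁X =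
  trans (cong suc (∣∪∣-split X A B (drop-∷-⊆ A⊆X) (drop-∷-⊆ B⊆∁X))) (sym (+-suc ∣ A ∣ ∣ B ∣))
∣∪∣-split (_ ∷ X) (false ∷ A) (false ∷ B) A⊆X B⊆∁X =
  ∣∪∣-split X A B (drop-∷-⊆ A⊆X) (drop-∷-⊆ B⊆∁X)

∣∩∣+∣∩∁∣ : ∀ {n} (T X : Subset n) → ∣ T ∩ X ∣ + ∣ T ∩ ∁ X ∣ ≡ ∣ T ∣
∣∩∣+∣∩∁∣ []          []          = refl
∣∩∣+∣∩∁∣ (true  ∷ T) (true  ∷ X) = cong suc (∣∩∣+∣∩∁∣ T X)
∣∩∣+∣∩∁∣ (true  ∷ T) (false ∷ X) = trans (+-suc ∣ T ∩ X ∣ ∣ T ∩ ∁ X ∣) (cong suc (∣∩∣+∣∩∁∣ T X))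
∣∩∣+∣∩∁∣ (false ∷ T) (true  ∷ X) = ∣∩∣+∣∩∁∣ T X
∣∩∣+∣∩∁∣ (false ∷ T) (false ∷ X) = ∣∩∣+∣∩∁∣ T X

trace-sizes : ∀ {n} (T X : Subset n) {t} → ∣ T ∣ ≡ t →
  ∣ T ∩ X ∣ ≤ t × ∣ T ∩ ∁ X ∣ ≡ t ∸ ∣ T ∩ X ∣
trace-sizes T X refl =
  subst (∣ T ∩ X ∣ ≤_) split (m≤m+n ∣ T ∩ X ∣ ∣ T ∩ ∁ X ∣) ,
  sym (trans (cong (_∸ ∣ T ∩ X ∣) (sym split)) (m+n∸m≡n ∣ T ∩ X ∣ ∣ T ∩ ∁ X ∣))
  where
  split : ∣ T ∩ X ∣ + ∣ T ∩ ∁ X ∣ ≡ ∣ T ∣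
  split = ∣∩∣+∣∩∁∣ T X

count-++ : ∀ {v} (S : Subset v) (xs ys : List (Subset v)) →
  count S (xs ++ ys) ≡ count S xs + count S ys
count-++ S xs ys =
  trans (cong length (filter-++ (S ⊆?_) xs ys)) (length-++ (filter (S ⊆?_) xs))

count-concatMap : ∀ {v} {I : Set} (S : Subset v) (f : I → List (Subset v)) (is : List I) →
  count S (concatMap f is) ≡ sum (map (λ i → count S (f i)) is)
count-concatMap S f []       = refl
count-concatMap S f (i ∷ is) =
  trans (count-++ S (f i) (concatMap f is)) (cong (count S (f i) +_) (count-concatMap S f is))

count-if : ∀ {v} (S : Subset v) (b : Bool) (xs : List (Subset v)) →
  count S (if b then xs else []) ≡ bit b * count S xs
count-if S true  xs = sym (*-identityˡ (count S xs))
count-if S false xs = refl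

count-map-⇔ : ∀ {v} (f : Subset v → Subset v) {S T : Subset v} (Bs : List (Subset v)) →
  (∀ {B} → B ∈ Bs → (T ⊆ f B ⇔ S ⊆ B)) → count T (map f Bs) ≡ count S Bs
count-map-⇔ f         []       _ = refl
count-map-⇔ f {S} {T} (B ∷ Bs) T⇔S with T ⊆? f B | S ⊆? B
... | yes T⊆ | yes _   = cong suc (count-map-⇔ f Bs (T⇔S ∘ there))
... | yes T⊆ | no  S⊈ = ⊥-elim (S⊈ (Equivalence.to (T⇔S (here refl)) T⊆))
... | no  T⊈ | yes S⊆ = ⊥-elim (T⊈ (Equivalence.from (T⇔S (here refl)) S⊆))
... | no  _  | no  _   = count-map-⇔ f Bs (T⇔S ∘ there)

count-map-none : ∀ {v} (f : Subset v → Subset v) {T : Subset v} (Bs : List (Subset v)) →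
  (∀ {B} → B ∈ Bs → ¬ T ⊆ f B) → count T (map f Bs) ≡ 0
count-map-none f     []       _   = refl
count-map-none f {T} (B ∷ Bs) T⊈ with T ⊆? f B
... | yes T⊆ = ⊥-elim (T⊈ (here refl) T⊆)
... | no  _  = count-map-none f Bs (T⊈ ∘ there)

unique-map : ∀ {a b} {A : Set a} {B : Set b} (h : A → B) (g : B → A) {xs : List A} →
  Unique xs → (∀ {x} → x ∈ xs → g (h x) ≡ x) → Unique (map h xs)
unique-map h g {[]}     []         _    = []
unique-map h g {x ∷ xs} (x∉ ∷ uxs) g∘h =
  map⁺ (All.tabulate (λ {y} y∈ hx≡hy → All.lookup x∉ y∈
         (trans (sym (g∘h (here refl))) (trans (cong g hx≡hy) (g∘h (there y∈))))))
  ∷ unique-map h g uxs (g∘h ∘ there)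

-- If every element of f x carries the label x, the lists f x for distinct x
-- are disjoint, so concatMap f xs is repetition-free.
unique-concatMap : ∀ {a b} {A : Set a} {B : Set b} (f : A → List B) (label : B → A) {xs : List A} →
  Unique xs → (∀ {x} → x ∈ xs → Unique (f x)) → (∀ {x y} → x ∈ xs → y ∈ f x → label y ≡ x) →
  Unique (concatMap f xs)
unique-concatMap f label {[]}     []         _     _       = []
unique-concatMap f label {x ∷ xs} (x∉ ∷ uxs) uniqF labelled =
  ++⁺ (uniqF (here refl)) (unique-concatMap f label uxs (uniqF ∘ there) (labelled ∘ there)) disjoint
  where
  disjoint : ∀ {y} → ¬ (y ∈ f x × y ∈ concatMap f xs)
  disjoint (y∈fx , y∈rest) with find (∈-concatMap⁻ f y∈rest)
  ... | x′ , x′∈xs , y∈fx′ =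
    All.lookup x∉ x′∈xs (trans (sym (labelled (here refl) y∈fx)) (labelled (there x′∈xs) y∈fx′))

unique-if : ∀ {a} {A : Set a} (b : Bool) {xs : List A} → Unique xs → Unique (if b then xs else [])
unique-if true  uxs = uxs
unique-if false _   = []

module Product {v : ℕ} (X : Subset v) {As Bs : List (Subset v)}
                (As⊆X : All (_⊆ X) As) (Bs⊆∁X : All (_⊆ ∁ X) Bs) where

  ∈-combine⁻ : ∀ {C} → C ∈ combine As Bs → ∃₂ λ A B → A ∈ As × B ∈ Bs × C ≡ A ∪ B
  ∈-combine⁻ C∈ with find (∈-concatMap⁻ (λ A → map (A ∪_) Bs) C∈)
  ... | A , A∈ , C∈A∪Bs with ∈-map⁻ (A ∪_) C∈A∪Bs
  ... | B , B∈ , C≡A∪B = A , B , A∈ , B∈ , C≡A∪B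

  count-combine : ∀ T → count T (combine As Bs) ≡ count (T ∩ X) As * count (T ∩ ∁ X) Bs
  count-combine T = go As⊆X
    where
    open ≡-Reasoning
    go : ∀ {As′} → All (_⊆ X) As′ → count T (combine As′ Bs) ≡ count (T ∩ X) As′ * count (T ∩ ∁ X) Bs
    go []                      = refl
    go {A ∷ As′} (A⊆X ∷ As′⊆X) with (T ∩ X) ⊆? A
    ... | yes T∩X⊆A = begin
      count T (map (A ∪_) Bs ++ combine As′ Bs)           ≡⟨ count-++ T (map (A ∪_) Bs) (combine As′ Bs) ⟩
      count T (map (A ∪_) Bs) + count T (combine As′ Bs)  ≡⟨ cong₂ _+_ (count-map-⇔ (A ∪_) Bs tracesCovered) (go As′⊆X) ⟩
      count (T ∩ ∁ X) Bs + count (T ∩ X) As′ * count (T ∩ ∁ X) Bs ∎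
      where
      tracesCovered : ∀ {B} → B ∈ Bs → (T ⊆ A ∪ B ⇔ T ∩ ∁ X ⊆ B)
      tracesCovered B∈ = let open Split X A⊆X (All.lookup Bs⊆∁X B∈) in mk⇔ ⊆-∪⁻ʳ (⊆-∪⁺ T∩X⊆A)
    ... | no T∩X⊈A = begin
      count T (map (A ∪_) Bs ++ combine As′ Bs)           ≡⟨ count-++ T (map (A ∪_) Bs) (combine As′ Bs) ⟩
      count T (map (A ∪_) Bs) + count T (combine As′ Bs)  ≡⟨ cong₂ _+_ (count-map-none (A ∪_) Bs notCovered) (go As′⊆X) ⟩
      count (T ∩ X) As′ * count (T ∩ ∁ X) Bs ∎
      where
      notCovered : ∀ {B} → B ∈ Bs → ¬ T ⊆ A ∪ B
      notCovered B∈ = T∩X⊈A ∘ Split.⊆-∪⁻ˡ X A⊆X (All.lookup Bs⊆∁X B∈)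

  -- Distinct pairs give distinct unions, since A ∪ B has traces A and B.
  unique-combine : Unique As → Unique Bs → Unique (combine As Bs)
  unique-combine uAs uBs = unique-concatMap (λ A → map (A ∪_) Bs) (_∩ X) uAs uniqRow rowTrace
    where
    uniqRow : ∀ {A} → A ∈ As → Unique (map (A ∪_) Bs)
    uniqRow A∈ = unique-map (_ ∪_) (_∩ ∁ X) uBs
      (λ B∈ → Split.∪-traceᶜ X (All.lookup As⊆X A∈) (All.lookup Bs⊆∁X B∈))
    rowTrace : ∀ {A C} → A ∈ As → C ∈ map (A ∪_) Bs → C ∩ X ≡ A
    rowTrace {A} A∈ C∈ with ∈-map⁻ (A ∪_) C∈
    ... | B , B∈ , refl = Split.∪-trace X (All.lookup As⊆X A∈) (All.lookup Bs⊆∁X B∈)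

-- A repetition-free list of i-subsets of Y.  Complete i-designs and simple
-- t-designs with block size i both are such families.
record IsUniformFamily {v : ℕ} (Y : Subset v) (i : ℕ) (Bs : List (Subset v)) : Set where
  field
    unique : Unique Bs
    blocks : All (λ B → (B ⊆ Y) × (∣ B ∣ ≡ i)) Bs

  inside : All (_⊆ Y) Bs
  inside = All.map proj₁ blocks

uniformFamilies : ∀ {v} (Y : Subset v) (t k : ℕ) (E : ℕ → List (Subset v)) (lm : ℕ → ℕ → ℕ) →
  (∀ i → i ≤ t → IsComplete Y i (E i)) →
  (∀ i → t < i → i ≤ k → IsSimpleDesign Y t i (lm i t) (E i)) →
  ∀ {i} → i ≤ k → IsUniformFamily Y i (E i)
uniformFamilies Y t k E lm complete design {i} i≤k with i ≤? t
... | yes i≤t = record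
  { unique = proj₁ (complete i i≤t)
  ; blocks = All.tabulate (Equivalence.to (proj₂ (complete i i≤t) _)) }
... | no  i≰t = record
  { unique = proj₁ (design i (≰⇒> i≰t) i≤k)
  ; blocks = proj₁ (proj₂ (design i (≰⇒> i≰t) i≤k)) }

∈-if⁻ : ∀ {a} {A : Set a} (b : Bool) {xs : List A} {x : A} → x ∈ (if b then xs else []) → x ∈ xs
∈-if⁻ true x∈ = x∈

upTo-suc⁻ : ∀ {k i} → i ∈ upTo (suc k) → i ≤ k
upTo-suc⁻ i∈ with ∈-upTo⁻ i∈
... | s≤s i≤k = i≤k

selectedLayer : ∀ {v} → ℕ → (ℕ → Bool) → (ℕ → List (Subset v)) → (ℕ → List (Subset v)) →
  ℕ → List (Subset v)
selectedLayer k u D D̄ i = if u i then combine (D i) (D̄ (k ∸ i)) else []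

module Union {v : ℕ} (X : Subset v) (k : ℕ) (u : ℕ → Bool) (D D̄ : ℕ → List (Subset v))
             (uniformD : ∀ {i} → i ≤ k → IsUniformFamily X i (D i))
             (uniformD̄ : ∀ {j} → j ≤ k → IsUniformFamily (∁ X) j (D̄ j)) where

  layer : ℕ → List (Subset v)
  layer = selectedLayer k u D D̄

  union : List (Subset v)
  union = unionBlocks k u D D̄

  private
    module Layer {i : ℕ} (i≤k : i ≤ k) where
      open IsUniformFamily (uniformD i≤k) renaming (unique to uniqueD; blocks to blocksD; inside to insideD) public
      open IsUniformFamily (uniformD̄ (m∸n≤m k i)) renaming (unique to uniqueD̄; blocks to blocksD̄; inside to insideD̄) public
      open Product X insideD insideD̄ public

  layer-block : ∀ {i C} → i ≤ k → C ∈ layer i → ∣ C ∩ X ∣ ≡ i × ∣ C ∣ ≡ k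
  layer-block {i} i≤k C∈ with Layer.∈-combine⁻ i≤k (∈-if⁻ (u i) C∈)
  ... | A , B , A∈ , B∈ , refl with All.lookup (Layer.blocksD i≤k) A∈ | All.lookup (Layer.blocksD̄ i≤k) B∈
  ... | A⊆X , ∣A∣≡i | B⊆∁X , ∣B∣≡k-i =
    trans (cong ∣_∣ (Split.∪-trace X A⊆X B⊆∁X)) ∣A∣≡i ,
    trans (∣∪∣-split X A B A⊆X B⊆∁X) (trans (cong₂ _+_ ∣A∣≡i ∣B∣≡k-i) (m+[n∸m]≡n i≤k))

  union-blocks : All (λ C → (C ⊆ ⊤) × (∣ C ∣ ≡ k)) union
  union-blocks = All.tabulate blockOf
    where
    blockOf : ∀ {C} → C ∈ union → (C ⊆ ⊤) × (∣ C ∣ ≡ k)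
    blockOf C∈ with find (∈-concatMap⁻ layer C∈)
    ... | i , i∈ , C∈layer = ⊆⊤ , proj₂ (layer-block (upTo-suc⁻ i∈) C∈layer)

  -- Layers are repetition-free and labelled by |C ∩ X|, so the union is simple.
  union-unique : Unique union
  union-unique = unique-concatMap layer (λ C → ∣ C ∩ X ∣) (upTo⁺ (suc k))
    (λ {i} i∈ → unique-if (u i) (Layer.unique-combine (upTo-suc⁻ i∈) (Layer.uniqueD (upTo-suc⁻ i∈)) (Layer.uniqueD̄ (upTo-suc⁻ i∈))))
    (λ i∈ C∈ → proj₁ (layer-block (upTo-suc⁻ i∈) C∈))

  count-union : ∀ T → count T union ≡
    sum (map (λ i → bit (u i) * count (T ∩ X) (D i) * count (T ∩ ∁ X) (D̄ (k ∸ i))) (upTo (suc k)))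
  count-union T = trans (count-concatMap T layer (upTo (suc k)))
    (cong sum (map-cong-local (All.tabulate λ {i} i∈ →
      trans (count-if T (u i) (combine (D i) (D̄ (k ∸ i))))
            (trans (cong (bit (u i) *_) (Layer.count-combine (upTo-suc⁻ i∈) T))
                   (sym (*-assoc (bit (u i)) _ _))))))

theorem1 : (v k t : ℕ) → 2 ≤ t → t < k → k < v →
    (X₁ : Subset v) →
    (D D̄ : ℕ → List (Subset v)) →
    (lam lam̄ : ℕ → ℕ → ℕ) →
    (∀ i → i ≤ t → IsComplete X₁ i (D i)) →
    (∀ i → t < i → i ≤ k → IsSimpleDesign X₁ t i (lam i t) (D i)) →
    (∀ i → i ≤ t → IsComplete (∁ X₁) i (D̄ i)) →
    (∀ i → t < i → i ≤ k → IsSimpleDesign (∁ X₁) t i (lam̄ i t) (D̄ i)) →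
    (∀ i → i ≤ k → ∀ s → s ≤ t → ∀ S → S ⊆ X₁ → ∣ S ∣ ≡ s → count S (D i) ≡ lam i s) →
    (∀ i → i ≤ k → ∀ s → s ≤ t → ∀ S → S ⊆ ∁ X₁ → ∣ S ∣ ≡ s → count S (D̄ i) ≡ lam̄ i s) →
    (u : ℕ → Bool) →
    (Λ : ℕ) → 0 < Λ →
    (∀ s → s ≤ t → L k t u lam lam̄ s ≡ Λ) →
    IsSimpleDesign ⊤ t k Λ (unionBlocks k u D D̄)
theorem1 v k t _ _ _ X₁ D D̄ lam lam̄ completeD designD completeD̄ designD̄ countD countD̄ u Λ _ L≡Λ =
  union-unique , union-blocks , balanced
  where
  open Union X₁ k u D D̄ (uniformFamilies X₁ t k D lam completeD designD)
                        (uniformFamilies (∁ X₁) t k D̄ lam̄ completeD̄ designD̄)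

  -- A t-set T with s points in X₁ lies in u_i λ^(i)_s λ̄^(k-i)_(t-s) blocks of layer i.
  balanced : ∀ T → T ⊆ ⊤ → ∣ T ∣ ≡ t → count T union ≡ Λ
  balanced T _ ∣T∣≡t with trace-sizes T X₁ ∣T∣≡t
  ... | s≤t , ∣T∩X₂∣≡t-s = begin
    count T union                       ≡⟨ count-union T ⟩
    sum (map (λ i → bit (u i) * count (T ∩ X₁) (D i) * count (T ∩ ∁ X₁) (D̄ (k ∸ i))) (upTo (suc k)))
      ≡⟨ cong sum (map-cong-local (All.tabulate traceCounts)) ⟩
    L k t u lam lam̄ s                   ≡⟨ L≡Λ s s≤t ⟩
    Λ                                   ∎
    where
    open ≡-Reasoning
    s : ℕ
    s = ∣ T ∩ X₁ ∣
    traceCounts : ∀ {i} → i ∈ upTo (suc k) →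
      bit (u i) * count (T ∩ X₁) (D i) * count (T ∩ ∁ X₁) (D̄ (k ∸ i)) ≡ bit (u i) * lam i s * lam̄ (k ∸ i) (t ∸ s)
    traceCounts {i} i∈ = cong₂ (λ a b → bit (u i) * a * b)
      (countD i (upTo-suc⁻ i∈) s s≤t (T ∩ X₁) (p∩q⊆q T X₁) refl)
      (countD̄ (k ∸ i) (m∸n≤m k i) (t ∸ s) (m∸n≤m t s) (T ∩ ∁ X₁) (p∩q⊆q T (∁ X₁)) ∣T∩X₂∣≡t-s)
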